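{- If $\pi$ is a rectangular permutation, then each of $\psi_1(\pi)$, $\psi_2(\pi)$, $\psi_u(\pi)$, $\psi_d(\pi)$ that is defined is also rectangular.
   Context: Permutations are in one-line form; $e_0$ is the empty permutation. A permutation is rectangular if it avoids each of $2413, 2431, 4213, 4231$. For $\pi\in S_n$, $1\le i,j\le n+1$, $\rho_{i,j}(\pi)\in S_{n+1}$ increases by $1$ every entry $\ge i$ and inserts the value $i$ at position $j$. $\psi_1=\rho_{1,1}$ (defined on all rectangular permutations); $\psi_2=\rho_{1,2}$ (defined on rectangular $\pi$ of size $\ge 2$ with $\pi_1\neq1$); $\psi_u(\pi)=\rho_{\pi_1,1}(\pi)$ (defined on rectangular $\pi$ of size $\ge2$ with $\pi_1\ne1$); $\psi_d(\pi)=\rho_{\pi_1+1,1}(\pi)$ (defined on rectangular $\pi$ of size $\ge1$). -}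

module Defs where

open import Data.Nat using (ℕ; zero; suc; _<_; _≤ᵇ_; _∸_)
open import Data.Bool using (if_then_else_)
open import Data.List using (List; []; _∷_; map; upTo)
open import Data.List.Relation.Binary.Sublist.Propositional using (_⊆_)
open import Data.List.Relation.Binary.Permutation.Propositional using (_↭_)
open import Data.List.Relation.Binary.Pointwise using (Pointwise)
open import Data.Product using (Σ; _×_)
open import Function.Bundles using (_⇔_)
open import Relation.Nullary using (¬_)

IsPerm : ℕ → List ℕ → Set
IsPerm n π = π ↭ map suc (upTo n)

data OrderIso : List ℕ → List ℕ → Set where
  []  : OrderIso [] []
  _∷_ : ∀ {x y xs ys} →
        Pointwise (λ x′ y′ → (x < x′ ⇔ y < y′) × (x′ < x ⇔ y′ < y)) xs ys →
        OrderIso xs ys → OrderIso (x ∷ xs) (y ∷ ys)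

Contains : List ℕ → List ℕ → Set
Contains p π = Σ (List ℕ) (λ σ → σ ⊆ π × OrderIso σ p)

Avoids : List ℕ → List ℕ → Set
Avoids π p = ¬ Contains p π

Rectangular : List ℕ → Set
Rectangular π =
  Avoids π (2 ∷ 4 ∷ 1 ∷ 3 ∷ []) × Avoids π (2 ∷ 4 ∷ 3 ∷ 1 ∷ []) ×
  Avoids π (4 ∷ 2 ∷ 1 ∷ 3 ∷ []) × Avoids π (4 ∷ 2 ∷ 3 ∷ 1 ∷ [])

insertAt : ℕ → ℕ → List ℕ → List ℕ
insertAt zero    v xs       = v ∷ xs
insertAt (suc k) v []       = v ∷ []
insertAt (suc k) v (x ∷ xs) = x ∷ insertAt k v xs

-- ρ i j π : increase by 1 every entry ≥ i, then insert value i at (1-based) position j.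
ρ : ℕ → ℕ → List ℕ → List ℕ
ρ i j π = insertAt (j ∸ 1) i (map (λ a → if i ≤ᵇ a then suc a else a) π)

ψ₁ : List ℕ → List ℕ
ψ₁ = ρ 1 1

ψ₂ : List ℕ → List ℕ
ψ₂ = ρ 1 2

ψu : List ℕ → List ℕ
ψu []           = []
ψu π@(x ∷ _)    = ρ x 1 π

ψd : List ℕ → List ℕ
ψd []           = []
ψd π@(x ∷ _)    = ρ (suc x) 1 π

-- first entry π₁ (only meaningful for nonempty π; 0 for the empty list)
first : List ℕ → ℕ
first []      = 0
first (x ∷ _) = x

{-# OPTIONS --safe #-}
-- The relabelling of the old entries in ρ is strictly increasing, so an occurrence of a
-- pattern in ρ_{i,j}(π) that avoids the inserted entry is already an occurrence in π.  Each of
-- 2413, 2431, 4213, 4231 has an entry below its first entry and below its second entry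
-- further to the right, so a new minimum placed first (ψ₁) or second (ψ₂) cannot take
-- part in an occurrence.  For ψᵤ and ψ_d the inserted value i and its right neighbour
-- are consecutive values, so no other entry separates them: an occurrence using i but
-- not its neighbour can use the neighbour instead, and none uses both because every
-- pattern has a later entry strictly between its first two entries (the 3).
module Submission where

open import Defs
open import Data.Nat using (ℕ; _≤_)
open import Data.List using (List)
open import Data.Product using (_×_)
open import Relation.Binary.PropositionalEquality using (_≢_)

open import Data.Nat using (suc; _<_; _≤ᵇ_; _≤?_; z≤n; s≤s; s<s; z<s)
open import Data.Nat.Properties
open import Data.Bool using (true; false; if_then_else_)
open import Data.Empty using (⊥)
open import Data.Sum using (_⊎_; inj₁; inj₂)
open import Data.Product using (Σ; _,_; proj₁; proj₂)
open import Data.List using ([]; _∷_; map; upTo; drop)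
open import Data.List.Relation.Unary.All using (All; []; _∷_; lookupAny; universal)
import Data.List.Relation.Unary.All as All
import Data.List.Relation.Unary.All.Properties as All
open import Data.List.Relation.Unary.Any using (Any; here; there)
open import Data.List.Relation.Unary.AllPairs using (_∷_)
open import Data.List.Relation.Unary.Unique.Propositional using (Unique)
import Data.List.Relation.Unary.Unique.Propositional.Properties as Unique
open import Data.List.Relation.Binary.Sublist.Propositional using (_⊆_; []; _∷_; _∷ʳ_)
open import Data.List.Relation.Binary.Sublist.Propositional.Properties using (All-resp-⊆)
open import Data.List.Relation.Binary.Permutation.Propositional using (↭-sym; ↭⇒↭ₛ)
open import Data.List.Relation.Binary.Permutation.Propositional.Properties using (All-resp-↭)
open import Data.List.Relation.Binary.Permutation.Setoid.Properties using (Unique-resp-↭)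
open import Data.List.Relation.Binary.Pointwise using (Pointwise; []; _∷_)
open import Function.Bundles using (_⇔_; mk⇔; Equivalence)
open import Function.Construct.Composition using (_⇔-∘_)
open import Function.Construct.Symmetry using (⇔-sym)
open import Relation.Binary.PropositionalEquality using (_≡_; refl; sym; cong; setoid)
open import Relation.Nullary using (¬_; yes; no; contradiction)
open import Relation.Nullary.Reflects using (ofʸ; ofⁿ)
open import Relation.Binary.Definitions using (tri<; tri≈; tri>)

open Equivalence using (to; from)

shift : ℕ → ℕ → ℕ
shift i a = if i ≤ᵇ a then suc a else a

shift-≥ : ∀ {i a} → i ≤ a → shift i a ≡ suc a
shift-≥ {i} {a} i≤a with i ≤ᵇ a | ≤ᵇ-reflects-≤ i a
... | true  | _        = refl
... | false | ofⁿ i≰a = contradiction i≤a i≰a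

shift-< : ∀ {i a} → a < i → shift i a ≡ a
shift-< {i} {a} a<i with i ≤ᵇ a | ≤ᵇ-reflects-≤ i a
... | false | _        = refl
... | true  | ofʸ i≤a = contradiction i≤a (<⇒≱ a<i)

shift-self : ∀ x → shift x x ≡ suc x
shift-self x = shift-≥ ≤-refl

shift-suc-self : ∀ x → shift (suc x) x ≡ x
shift-suc-self x = shift-< ≤-refl

shift-≢ : ∀ i a → shift i a ≢ i
shift-≢ i a with i ≤? a
... | yes i≤a rewrite shift-≥ i≤a = λ eq → <-irrefl (sym eq) (s≤s i≤a)
... | no  i≰a rewrite shift-< (≰⇒> i≰a) = λ eq → <-irrefl eq (≰⇒> i≰a)

shift-mono-< : ∀ i {a b} → a < b → shift i a < shift i b
shift-mono-< i {a} {b} a<b with i ≤? a | i ≤? b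
... | yes i≤a | _
  rewrite shift-≥ i≤a | shift-≥ (≤-trans i≤a (<⇒≤ a<b)) = s<s a<b
... | no i≰a | yes i≤b rewrite shift-< (≰⇒> i≰a) | shift-≥ i≤b = m<n⇒m<1+n a<b
... | no i≰a | no i≰b  rewrite shift-< (≰⇒> i≰a) | shift-< (≰⇒> i≰b) = a<b

shift-> : ∀ {i a} → i ≤ a → i < shift i a
shift-> i≤a rewrite shift-≥ i≤a = s≤s i≤a

SameOrder : ℕ → ℕ → ℕ → ℕ → Set
SameOrder x y x′ y′ = (x < x′ ⇔ y < y′) × (x′ < x ⇔ y′ < y)

⊆-map⁻ : ∀ {A B : Set} {f : A → B} {σ} π → σ ⊆ map f π → Σ (List A) λ τ → τ ⊆ π × σ ≡ map f τ
⊆-map⁻ []      []       = [] , [] , refl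
⊆-map⁻ (x ∷ π) (_ ∷ʳ s) with ⊆-map⁻ π s
... | τ , τ⊆π , refl = τ , x ∷ʳ τ⊆π , refl
⊆-map⁻ (x ∷ π) (refl ∷ s) with ⊆-map⁻ π s
... | τ , τ⊆π , refl = x ∷ τ , refl ∷ τ⊆π , refl

module StrictlyIncreasing {f : ℕ → ℕ} (f-mono : ∀ {a b} → a < b → f a < f b) where

  reflects-< : ∀ {a b} → f a < f b → a < b
  reflects-< {a} {b} fa<fb with <-cmp a b
  ... | tri< a<b _ _ = a<b
  ... | tri≈ _ refl _ = contradiction fa<fb (<-irrefl refl)
  ... | tri> _ _ b<a = contradiction fa<fb (<-asym (f-mono b<a))

  <⇔< : ∀ {a b} → (a < b) ⇔ (f a < f b)
  <⇔< = mk⇔ f-mono reflects-<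

  injective : ∀ {a b} → f a ≡ f b → a ≡ b
  injective {a} {b} fa≡fb with <-cmp a b
  ... | tri< a<b _ _ = contradiction fa≡fb (<⇒≢ (f-mono a<b))
  ... | tri≈ _ a≡b _ = a≡b
  ... | tri> _ _ b<a = contradiction (sym fa≡fb) (<⇒≢ (f-mono b<a))

  private
    SameOrder-map⁻ : ∀ {t c} τ {q} →
      Pointwise (SameOrder (f t) c) (map f τ) q → Pointwise (SameOrder t c) τ q
    SameOrder-map⁻ []      []               = []
    SameOrder-map⁻ (_ ∷ τ) ((e₁ , e₂) ∷ pw) = (e₁ ⇔-∘ <⇔< , e₂ ⇔-∘ <⇔<) ∷ SameOrder-map⁻ τ pw

  OrderIso-map⁻ : ∀ τ {p} → OrderIso (map f τ) p → OrderIso τ p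
  OrderIso-map⁻ []      []         = []
  OrderIso-map⁻ (_ ∷ τ) (pw ∷ iso) = SameOrder-map⁻ τ pw ∷ OrderIso-map⁻ τ iso

  Contains-map⁻ : ∀ π {p} → Contains p (map f π) → Contains p π
  Contains-map⁻ π (σ , σ⊆fπ , iso) with ⊆-map⁻ π σ⊆fπ
  ... | τ , τ⊆π , refl = τ , τ⊆π , OrderIso-map⁻ τ iso

shift-above : ∀ {i π} → All (i ≤_) π → All (i <_) (map (shift i) π)
shift-above i≤π = All.map⁺ (All.map shift-> i≤π)

HasSmallerLater : List ℕ → Set
HasSmallerLater []      = ⊥
HasSmallerLater (c ∷ q) = Any (_< c) q

Between : ℕ → ℕ → ℕ → Set
Between u v z = (u < z × z < v) ⊎ (v < z × z < u)

HasBetweenLater : List ℕ → Set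
HasBetweenLater (c ∷ d ∷ q) = Any (Between c d) q
HasBetweenLater _           = ⊥

SameOrder-Any-below : ∀ {x y xs ys} →
  Pointwise (SameOrder x y) xs ys → Any (_< y) ys → Any (_< x) xs
SameOrder-Any-below (e ∷ _)  (here z<y) = here (from (proj₂ e) z<y)
SameOrder-Any-below (_ ∷ pw) (there zs) = there (SameOrder-Any-below pw zs)

SameOrder-Any-between : ∀ {u v c d xs ys} →
  Pointwise (SameOrder u c) xs ys → Pointwise (SameOrder v d) xs ys →
  Any (Between c d) ys → Any (Between u v) xs
SameOrder-Any-between (e ∷ _) (e′ ∷ _) (here (inj₁ (c<z , z<d))) =
  here (inj₁ (from (proj₁ e) c<z , from (proj₂ e′) z<d))
SameOrder-Any-between (e ∷ _) (e′ ∷ _) (here (inj₂ (d<z , z<c))) =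
  here (inj₂ (from (proj₁ e′) d<z , from (proj₂ e) z<c))
SameOrder-Any-between (_ ∷ pw) (_ ∷ pw′) (there zs) = there (SameOrder-Any-between pw pw′ zs)

¬OrderIso-minimum-head : ∀ {b σ p} → HasSmallerLater p → All (b <_) σ → ¬ OrderIso (b ∷ σ) p
¬OrderIso-minimum-head {p = _ ∷ _} smaller b<σ (pw ∷ _)
  with lookupAny b<σ (SameOrder-Any-below pw smaller)
... | b<z , z<b = <-asym b<z z<b

drop-minimum-head : ∀ {b L p} → HasSmallerLater p → All (b <_) L →
  Contains p (b ∷ L) → Contains p L
drop-minimum-head _ _ (σ , _ ∷ʳ σ⊆L , iso) = σ , σ⊆L , iso
drop-minimum-head smaller b<L (_ , refl ∷ σ⊆L , iso) =
  contradiction iso (¬OrderIso-minimum-head smaller (All-resp-⊆ σ⊆L b<L))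

drop-minimum-second : ∀ {a b L p} → HasSmallerLater p → HasSmallerLater (drop 1 p) →
  All (b <_) L → Contains p (a ∷ b ∷ L) → Contains p (a ∷ L)
drop-minimum-second {a} smaller _ b<L (σ , _ ∷ʳ σ⊆bL , iso)
  with drop-minimum-head smaller b<L (σ , σ⊆bL , iso)
... | σ′ , σ′⊆L , iso′ = σ′ , a ∷ʳ σ′⊆L , iso′
drop-minimum-second _ _ _ (_ , refl ∷ (_ ∷ʳ σ⊆L) , iso) = _ , refl ∷ σ⊆L , iso
drop-minimum-second {p = _ ∷ _} _ smaller b<L (_ , refl ∷ (refl ∷ σ⊆L) , _ ∷ iso) =
  contradiction iso (¬OrderIso-minimum-head smaller (All-resp-⊆ σ⊆L b<L))

SameSide : ℕ → ℕ → ℕ → Set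
SameSide u v y = (u < y ⇔ v < y) × (y < u ⇔ y < v)

SameSide-sym : ∀ {u v y} → SameSide u v y → SameSide v u y
SameSide-sym (s₁ , s₂) = ⇔-sym s₁ , ⇔-sym s₂

SameSide⇒¬Between : ∀ {u v y} → SameSide u v y → ¬ Between u v y
SameSide⇒¬Between (s₁ , _) (inj₁ (u<y , y<v)) = <-asym y<v (to s₁ u<y)
SameSide⇒¬Between (_ , s₂) (inj₂ (v<y , y<u)) = <-asym v<y (to s₂ y<u)

SameOrder-swap : ∀ {u v c σ q} → All (SameSide u v) σ →
  Pointwise (SameOrder u c) σ q → Pointwise (SameOrder v c) σ q
SameOrder-swap []                 []                = []
SameOrder-swap ((s₁ , s₂) ∷ same) ((e₁ , e₂) ∷ pw) =
  (e₁ ⇔-∘ ⇔-sym s₁ , e₂ ⇔-∘ ⇔-sym s₂) ∷ SameOrder-swap same pw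

¬OrderIso-separated-front : ∀ {u v σ p} → HasBetweenLater p → All (SameSide u v) σ →
  ¬ OrderIso (u ∷ v ∷ σ) p
¬OrderIso-separated-front {p = _ ∷ _ ∷ _} between same ((_ ∷ pwᵤ) ∷ pwᵥ ∷ _)
  with lookupAny same (SameOrder-Any-between pwᵤ pwᵥ between)
... | sameSide , separated = SameSide⇒¬Between sameSide separated

merge-unseparated-front : ∀ {u v L p} → HasBetweenLater p → All (SameSide u v) L →
  Contains p (u ∷ v ∷ L) → Contains p (v ∷ L)
merge-unseparated-front _ _ (σ , _ ∷ʳ σ⊆vL , iso) = σ , σ⊆vL , iso
merge-unseparated-front {v = v} _ same (_ ∷ σ , refl ∷ (_ ∷ʳ σ⊆L) , pw ∷ iso) =
  v ∷ σ , refl ∷ σ⊆L , SameOrder-swap (All-resp-⊆ σ⊆L same) pw ∷ iso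
merge-unseparated-front between same (_ , refl ∷ (refl ∷ σ⊆L) , iso) =
  contradiction iso (¬OrderIso-separated-front between (All-resp-⊆ σ⊆L same))

Adjacent : ℕ → ℕ → Set
Adjacent u v = v ≡ suc u ⊎ u ≡ suc v

SameSide-suc : ∀ {u y} → y ≢ u → y ≢ suc u → SameSide u (suc u) y
SameSide-suc {u} y≢u y≢su =
  mk⇔ (λ u<y → ≤∧≢⇒< u<y (λ eq → y≢su (sym eq))) (<-trans (n<1+n u)) ,
  mk⇔ m<n⇒m<1+n (λ y<su → ≤∧≢⇒< (≤-pred y<su) y≢u)

Adjacent⇒SameSide : ∀ {u v y} → Adjacent u v → y ≢ u → y ≢ v → SameSide u v y
Adjacent⇒SameSide (inj₁ refl) y≢u y≢v = SameSide-suc y≢u y≢v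
Adjacent⇒SameSide (inj₂ refl) y≢u y≢v = SameSide-sym (SameSide-suc y≢v y≢u)

Contains-ρ-front-minimum⁻ : ∀ {i} π {p} → HasSmallerLater p → All (i ≤_) π →
  Contains p (ρ i 1 π) → Contains p π
Contains-ρ-front-minimum⁻ {i} π smaller i≤π occurrence =
  StrictlyIncreasing.Contains-map⁻ (shift-mono-< i) π
    (drop-minimum-head smaller (shift-above i≤π) occurrence)

Contains-ρ-second-minimum⁻ : ∀ {i} π {p} → HasSmallerLater p → HasSmallerLater (drop 1 p) →
  All (i ≤_) π → Contains p (ρ i 2 π) → Contains p π
Contains-ρ-second-minimum⁻ []         smaller _ _ occurrence = drop-minimum-head smaller [] occurrence
Contains-ρ-second-minimum⁻ {i} (x ∷ rest) smaller smaller′ (_ ∷ i≤rest) occurrence =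
  StrictlyIncreasing.Contains-map⁻ (shift-mono-< i) (x ∷ rest)
    (drop-minimum-second smaller smaller′ (shift-above i≤rest) occurrence)

Contains-ρ-front-adjacent⁻ : ∀ {i x} rest {p} → HasBetweenLater p → Adjacent i (shift i x) →
  All (x ≢_) rest → Contains p (ρ i 1 (x ∷ rest)) → Contains p (x ∷ rest)
Contains-ρ-front-adjacent⁻ {i} {x} rest between adjacent x≢rest occurrence =
  Contains-map⁻ (x ∷ rest)
    (merge-unseparated-front between (All.map⁺ (All.map sameSide x≢rest)) occurrence)
  where
  open StrictlyIncreasing (shift-mono-< i)

  sameSide : ∀ {a} → x ≢ a → SameSide i (shift i x) (shift i a)
  sameSide x≢a = Adjacent⇒SameSide adjacent (shift-≢ i _) (λ eq → x≢a (sym (injective eq)))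

data RectangularPattern : List ℕ → Set where
  p2413 : RectangularPattern (2 ∷ 4 ∷ 1 ∷ 3 ∷ [])
  p2431 : RectangularPattern (2 ∷ 4 ∷ 3 ∷ 1 ∷ [])
  p4213 : RectangularPattern (4 ∷ 2 ∷ 1 ∷ 3 ∷ [])
  p4231 : RectangularPattern (4 ∷ 2 ∷ 3 ∷ 1 ∷ [])

rectangular-reflect : ∀ {π π′} →
  (∀ {p} → RectangularPattern p → Contains p π′ → Contains p π) →
  Rectangular π → Rectangular π′
rectangular-reflect reflect (a , b , c , d) =
  (λ h → a (reflect p2413 h)) , (λ h → b (reflect p2431 h)) ,
  (λ h → c (reflect p4213 h)) , (λ h → d (reflect p4231 h))

RectangularPattern⇒HasSmallerLater : ∀ {p} → RectangularPattern p → HasSmallerLater p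
RectangularPattern⇒HasSmallerLater p2413 = there (here (s<s z<s))
RectangularPattern⇒HasSmallerLater p2431 = there (there (here (s<s z<s)))
RectangularPattern⇒HasSmallerLater p4213 = here (s<s (s<s z<s))
RectangularPattern⇒HasSmallerLater p4231 = here (s<s (s<s z<s))

RectangularPattern⇒HasSmallerLater-tail : ∀ {p} → RectangularPattern p → HasSmallerLater (drop 1 p)
RectangularPattern⇒HasSmallerLater-tail p2413 = here (s<s z<s)
RectangularPattern⇒HasSmallerLater-tail p2431 = here (s<s (s<s (s<s z<s)))
RectangularPattern⇒HasSmallerLater-tail p4213 = here (s<s z<s)
RectangularPattern⇒HasSmallerLater-tail p4231 = there (here (s<s z<s))

RectangularPattern⇒HasBetweenLater : ∀ {p} → RectangularPattern p → HasBetweenLater p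
RectangularPattern⇒HasBetweenLater p2413 = there (here (inj₁ (s<s (s<s z<s) , s<s (s<s (s<s z<s)))))
RectangularPattern⇒HasBetweenLater p2431 = here (inj₁ (s<s (s<s z<s) , s<s (s<s (s<s z<s))))
RectangularPattern⇒HasBetweenLater p4213 = there (here (inj₂ (s<s (s<s z<s) , s<s (s<s (s<s z<s)))))
RectangularPattern⇒HasBetweenLater p4231 = here (inj₂ (s<s (s<s z<s) , s<s (s<s (s<s z<s))))

IsPerm⇒positive : ∀ {n π} → IsPerm n π → All (1 ≤_) π
IsPerm⇒positive {n} π↭ = All-resp-↭ (↭-sym π↭) (All.map⁺ (universal (λ _ → s≤s z≤n) (upTo n)))

IsPerm⇒Unique : ∀ {n π} → IsPerm n π → Unique π
IsPerm⇒Unique {n} π↭ =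
  Unique-resp-↭ (setoid ℕ) (↭⇒↭ₛ (↭-sym π↭)) (Unique.map⁺ suc-injective (Unique.upTo⁺ n))

ψ₁-rectangular : ∀ {π} → All (1 ≤_) π → Rectangular π → Rectangular (ψ₁ π)
ψ₁-rectangular {π} positive = rectangular-reflect λ P →
  Contains-ρ-front-minimum⁻ π (RectangularPattern⇒HasSmallerLater P) positive

ψ₂-rectangular : ∀ {π} → All (1 ≤_) π → Rectangular π → Rectangular (ψ₂ π)
ψ₂-rectangular {π} positive = rectangular-reflect λ P →
  Contains-ρ-second-minimum⁻ π (RectangularPattern⇒HasSmallerLater P)
    (RectangularPattern⇒HasSmallerLater-tail P) positive

ψu-rectangular : ∀ {π} → Unique π → Rectangular π → Rectangular (ψu π)
ψu-rectangular {[]}       _            rect = rect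
ψu-rectangular {x ∷ rest} (x≢rest ∷ _) = rectangular-reflect λ P →
  Contains-ρ-front-adjacent⁻ rest (RectangularPattern⇒HasBetweenLater P)
    (inj₁ (shift-self x)) x≢rest

ψd-rectangular : ∀ {π} → Unique π → Rectangular π → Rectangular (ψd π)
ψd-rectangular {[]}       _            rect = rect
ψd-rectangular {x ∷ rest} (x≢rest ∷ _) = rectangular-reflect λ P →
  Contains-ρ-front-adjacent⁻ rest (RectangularPattern⇒HasBetweenLater P)
    (inj₂ (cong suc (sym (shift-suc-self x)))) x≢rest

mainTheorem4 : (n : ℕ) (π : List ℕ) → IsPerm n π → Rectangular π →
    Rectangular (ψ₁ π)
    × (2 ≤ n → first π ≢ 1 → Rectangular (ψ₂ π))
    × (2 ≤ n → first π ≢ 1 → Rectangular (ψu π))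
    × (1 ≤ n → Rectangular (ψd π))
mainTheorem4 n π isPerm rect =
    ψ₁-rectangular positive rect
  , (λ _ _ → ψ₂-rectangular positive rect)
  , (λ _ _ → ψu-rectangular unique rect)
  , (λ _ → ψd-rectangular unique rect)
  where
  positive : All (1 ≤_) π
  positive = IsPerm⇒positive isPerm

  unique : Unique π
  unique = IsPerm⇒Unique isPerm
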